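{- Let $n>k>t$ be positive integers and let $\mathcal{F},\mathcal{G}\subset\binom{[n]}{k}$ be a saturated pair of non-trivial cross $t$-intersecting families. Set $\mathcal{B}_1=\mathcal{B}(\mathcal{F})$, $\mathcal{B}_2=\mathcal{B}(\mathcal{G})$. Then neither $\mathcal{B}_1$ nor $\mathcal{B}_2$ contains a sunflower of $k-t+2$ petals with center of size $t$.
   Context: $\binom{[n]}{k}$ is the family of $k$-subsets of $[n]=\{1,\dots,n\}$. $\mathcal{F},\mathcal{G}$ are cross $t$-intersecting if $|F\cap G|\geq t$ for all $F\in\mathcal{F},G\in\mathcal{G}$; non-trivial if moreover $|\bigcap\{F\colon F\in\mathcal{F}\}|<t$ and $|\bigcap\{G\colon G\in\mathcal{G}\}|<t$; they form a saturated pair if adding any further $k$-subset of $[n]$ to either family destroys the cross $t$-intersecting property. For a family $\mathcal{H}$ of $k$-sets, $\mathcal{T}_t(\mathcal{H})$ is the family of all $T\subset[n]$ with $t\leq|T|\leq k$ and $|T\cap H|\geq t$ for all $H\in\mathcal{H}$. $\mathcal{B}(\mathcal{F})$ is the family of minimal (for containment) sets in $\mathcal{T}_t(\mathcal{G})$ and $\mathcal{B}(\mathcal{G})$ the family of minimal sets in $\mathcal{T}_t(\mathcal{F})$. A sunflower of $p$ petals with center $C$ is a collection of $p$ distinct sets $S_1,\dots,S_p$ with $S_i\cap S_j=C$ for all $i\neq j$. -}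

module Defs where

open import Data.Nat using (ℕ; _≤_; _<_)
open import Data.Fin using (Fin)
open import Data.Fin.Subset using (Subset; _∩_; _⊆_; ∣_∣; ⊤)
open import Data.List using (List; foldr)
open import Data.List.Membership.Propositional using (_∈_)
open import Data.Product using (_×_; Σ; ∃)
open import Relation.Nullary using (¬_)
open import Relation.Binary.PropositionalEquality using (_≡_; _≢_)

Family : ℕ → Set
Family n = List (Subset n)

IsKUniform : ∀ {n} → ℕ → Family n → Set
IsKUniform k 𝓕 = ∀ {F} → F ∈ 𝓕 → ∣ F ∣ ≡ k

CrossInt : ∀ {n} → ℕ → Family n → Family n → Set
CrossInt t 𝓕 𝓖 = ∀ {F G} → F ∈ 𝓕 → G ∈ 𝓖 → t ≤ ∣ F ∩ G ∣

-- ⋂ {F : F ∈ 𝓕}  (empty intersection = [n])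
⋂ : ∀ {n} → Family n → Subset n
⋂ 𝓕 = foldr _∩_ ⊤ 𝓕

NonTrivial : ∀ {n} → ℕ → Family n → Set
NonTrivial t 𝓕 = ∣ ⋂ 𝓕 ∣ < t

Saturated : ∀ {n} → ℕ → ℕ → Family n → Family n → Set
Saturated k t 𝓕 𝓖 =
  (∀ (S : Subset _) → ∣ S ∣ ≡ k → (∀ {G} → G ∈ 𝓖 → t ≤ ∣ S ∩ G ∣) → S ∈ 𝓕)
  × (∀ (S : Subset _) → ∣ S ∣ ≡ k → (∀ {F} → F ∈ 𝓕 → t ≤ ∣ S ∩ F ∣) → S ∈ 𝓖)

InT : ∀ {n} → ℕ → ℕ → Family n → Subset n → Set
InT k t 𝓗 T = t ≤ ∣ T ∣ × ∣ T ∣ ≤ k × (∀ {H} → H ∈ 𝓗 → t ≤ ∣ T ∩ H ∣)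

MinimalInT : ∀ {n} → ℕ → ℕ → Family n → Subset n → Set
MinimalInT k t 𝓗 T =
  InT k t 𝓗 T × (∀ T′ → T′ ⊆ T → T′ ≢ T → ¬ InT k t 𝓗 T′)

InB : ∀ {n} → ℕ → ℕ → (𝓕 𝓖 : Family n) → Subset n → Set
InB k t 𝓕 𝓖 = MinimalInT k t 𝓖

SunflowerIn : ∀ {n} → (Subset n → Set) → ℕ → Subset n → Set
SunflowerIn {n} P p C =
  Σ (Fin p → Subset n) λ S →
    (∀ i j → i ≢ j → S i ≢ S j)
    × (∀ i j → i ≢ j → S i ∩ S j ≡ C)
    × (∀ i → P (S i))

{-# OPTIONS --safe #-}
module Submission where

open import Defs
open import Data.Nat using (ℕ; _<_; _+_; _∸_; _*_; _≤_; zero; suc)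
open import Data.Nat.Properties
  using (+-suc; +-assoc; +-comm; +-identityʳ; *-identityˡ; *-suc; +-mono-≤; +-monoˡ-≤; +-monoʳ-≤;
         *-monoʳ-≤; +-cancelʳ-≤; m+[n∸m]≡n; n≮n; ≰⇒>; <⇒≤; _≤?_; ≤-trans; ≤-reflexive; module ≤-Reasoning)
open import Data.Fin using (Fin; zero; suc)
open import Data.Fin.Properties using (suc-injective)
open import Data.Fin.Subset using (Subset; ∣_∣; _∩_; _∪_; _⊆_; inside; outside)
open import Data.Fin.Subset.Properties
  using (p⊆q⇒∣p∣≤∣q∣; p∩q⊆p; p∩q⊆q; x∈p∪q⁻; ∩-distribˡ-∪; ∪-idem; ∩-idem; ∩-commutativeMonoid)
open import Algebra.Bundles using (CommutativeMonoid)
import Algebra.Properties.CommutativeSemigroup as CommSemigroupProperties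
open import Data.Vec using ([]; _∷_)
open import Data.Product using (_×_; _,_; proj₁; proj₂)
open import Data.Sum using ([_,_])
open import Relation.Nullary using (¬_; yes; no; contradiction)
open import Relation.Binary.PropositionalEquality
  using (_≡_; _≢_; refl; sym; trans; cong; cong₂; subst; subst₂; module ≡-Reasoning)
open import Function using (_∘_)

-- Let C be the t-element centre of a sunflower of k - t + 2 minimal
-- members of 𝓣_t(𝓗), for 𝓗 k-uniform. If some H ∈ 𝓗 met C in fewer than t
-- points, each petal would meet H in at least one point outside C; the petals
-- are disjoint outside C, so |H| ≥ |C ∩ H| + (k - t + 2)(t - |C ∩ H|) > k.
-- Hence C ∈ 𝓣_t(𝓗), and C is a proper subset of one of the (distinct) petals,
-- against minimality.

∣p∪q∣+∣p∩q∣≡∣p∣+∣q∣ : ∀ {n} (p q : Subset n) → ∣ p ∪ q ∣ + ∣ p ∩ q ∣ ≡ ∣ p ∣ + ∣ q ∣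
∣p∪q∣+∣p∩q∣≡∣p∣+∣q∣ []            []            = refl
∣p∪q∣+∣p∩q∣≡∣p∣+∣q∣ (inside  ∷ p) (inside  ∷ q) =
  cong suc (trans (+-suc _ _) (trans (cong suc (∣p∪q∣+∣p∩q∣≡∣p∣+∣q∣ p q)) (sym (+-suc _ _))))
∣p∪q∣+∣p∩q∣≡∣p∣+∣q∣ (inside  ∷ p) (outside ∷ q) = cong suc (∣p∪q∣+∣p∩q∣≡∣p∣+∣q∣ p q)
∣p∪q∣+∣p∩q∣≡∣p∣+∣q∣ (outside ∷ p) (inside  ∷ q) =
  trans (cong suc (∣p∪q∣+∣p∩q∣≡∣p∣+∣q∣ p q)) (sym (+-suc _ _))
∣p∪q∣+∣p∩q∣≡∣p∣+∣q∣ (outside ∷ p) (outside ∷ q) = ∣p∪q∣+∣p∩q∣≡∣p∣+∣q∣ p q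

p∩r∩[q∩r]≡p∩q∩r : ∀ {n} (p q r : Subset n) → (p ∩ r) ∩ (q ∩ r) ≡ (p ∩ q) ∩ r
p∩r∩[q∩r]≡p∩q∩r {n} p q r = trans (interchange p r q r) (cong ((p ∩ q) ∩_) (∩-idem r))
  where
  open CommSemigroupProperties (CommutativeMonoid.commutativeSemigroup (∩-commutativeMonoid n))

⋃⁺ : ∀ {n q} → (Fin (suc q) → Subset n) → Subset n
⋃⁺ {q = zero}  S = S zero
⋃⁺ {q = suc q} S = S zero ∪ ⋃⁺ (S ∘ suc)

⋃⁺-least : ∀ {n q} (S : Fin (suc q) → Subset n) {X : Subset n} → (∀ i → S i ⊆ X) → ⋃⁺ S ⊆ X
⋃⁺-least {q = zero}  S S⊆X = S⊆X zero
⋃⁺-least {q = suc q} S S⊆X x∈⋃ =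
  [ S⊆X zero , ⋃⁺-least (S ∘ suc) (S⊆X ∘ suc) ] (x∈p∪q⁻ (S zero) (⋃⁺ (S ∘ suc)) x∈⋃)

p∩⋃⁺≡c : ∀ {n q} (p c : Subset n) (S : Fin (suc q) → Subset n) → (∀ i → p ∩ S i ≡ c) → p ∩ ⋃⁺ S ≡ c
p∩⋃⁺≡c {q = zero}  p c S p∩S≡c = p∩S≡c zero
p∩⋃⁺≡c {q = suc q} p c S p∩S≡c = begin
  p ∩ (S zero ∪ ⋃⁺ (S ∘ suc))          ≡⟨ ∩-distribˡ-∪ p (S zero) (⋃⁺ (S ∘ suc)) ⟩
  (p ∩ S zero) ∪ (p ∩ ⋃⁺ (S ∘ suc))    ≡⟨ cong₂ _∪_ (p∩S≡c zero) (p∩⋃⁺≡c p c (S ∘ suc) (p∩S≡c ∘ suc)) ⟩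
  c ∪ c                                ≡⟨ ∪-idem c ⟩
  c                                    ∎
  where open ≡-Reasoning

IsSunflower : ∀ {n p} → (Fin p → Subset n) → Subset n → Set
IsSunflower S C = ∀ i j → i ≢ j → S i ∩ S j ≡ C

sunflower-tail : ∀ {n p} {S : Fin (suc p) → Subset n} {C : Subset n} →
  IsSunflower S C → IsSunflower (S ∘ suc) C
sunflower-tail sf i j i≢j = sf (suc i) (suc j) (i≢j ∘ suc-injective)

sunflower-∩ : ∀ {n p} {S : Fin p → Subset n} {C : Subset n} (G : Subset n) →
  IsSunflower S C → IsSunflower (λ i → S i ∩ G) (C ∩ G)
sunflower-∩ {S = S} G sf i j i≢j =
  trans (p∩r∩[q∩r]≡p∩q∩r (S i) (S j) G) (cong (_∩ G) (sf i j i≢j))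

core⊆petal : ∀ {n p} {S : Fin p → Subset n} {C : Subset n} →
  IsSunflower S C → ∀ i j → i ≢ j → C ⊆ S i
core⊆petal {S = S} sf i j i≢j = subst (_⊆ S i) (sf i j i≢j) (p∩q⊆p (S i) (S j))

sunflower-size : ∀ {n q t} (S : Fin (suc q) → Subset n) {C : Subset n} →
  IsSunflower S C → (∀ i → t ≤ ∣ S i ∣) → suc q * t ≤ ∣ ⋃⁺ S ∣ + q * ∣ C ∣
sunflower-size {q = zero} {t} S sf t≤∣S∣ =
  subst₂ _≤_ (sym (*-identityˡ t)) (sym (+-identityʳ _)) (t≤∣S∣ zero)
sunflower-size {q = suc q} {t} S {C} sf t≤∣S∣ = begin
  t + suc q * t                                 ≤⟨ +-mono-≤ (t≤∣S∣ zero) (sunflower-size (S ∘ suc) (sunflower-tail sf) (t≤∣S∣ ∘ suc)) ⟩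
  ∣ S zero ∣ + (∣ ⋃⁺ (S ∘ suc) ∣ + q * ∣ C ∣)    ≡⟨ sym (+-assoc ∣ S zero ∣ _ _) ⟩
  ∣ S zero ∣ + ∣ ⋃⁺ (S ∘ suc) ∣ + q * ∣ C ∣      ≡⟨ cong (_+ q * ∣ C ∣) (sym (∣p∪q∣+∣p∩q∣≡∣p∣+∣q∣ (S zero) (⋃⁺ (S ∘ suc)))) ⟩
  ∣ ⋃⁺ S ∣ + ∣ S zero ∩ ⋃⁺ (S ∘ suc) ∣ + q * ∣ C ∣ ≡⟨ cong (λ X → ∣ ⋃⁺ S ∣ + ∣ X ∣ + q * ∣ C ∣) S₀∩⋃≡C ⟩
  ∣ ⋃⁺ S ∣ + ∣ C ∣ + q * ∣ C ∣                    ≡⟨ +-assoc ∣ ⋃⁺ S ∣ ∣ C ∣ (q * ∣ C ∣) ⟩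
  ∣ ⋃⁺ S ∣ + suc q * ∣ C ∣                        ∎
  where
  open ≤-Reasoning
  S₀∩⋃≡C : S zero ∩ ⋃⁺ (S ∘ suc) ≡ C
  S₀∩⋃≡C = p∩⋃⁺≡c (S zero) C (S ∘ suc) (λ j → sf zero (suc j) (λ ()))

petal-count-bound : ∀ {k t s} → t ≤ k →
  suc (suc (k ∸ t)) * t ≤ k + suc (k ∸ t) * s → t ≤ s
petal-count-bound {k} {t} {s} t≤k bound with t ≤? s
... | yes t≤s = t≤s
... | no  t≰s = contradiction (+-cancelʳ-≤ (q * s) (suc k) k k+1+qs≤k+qs) (n≮n k)
  where
  open ≤-Reasoning
  q = suc (k ∸ t)
  k+1+qs≤k+qs : suc k + q * s ≤ k + q * s
  k+1+qs≤k+qs = begin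
    suc k + q * s       ≡⟨ cong (_+ q * s) (sym (trans (+-suc t (k ∸ t)) (cong suc (m+[n∸m]≡n t≤k)))) ⟩
    t + q + q * s       ≡⟨ +-assoc t q (q * s) ⟩
    t + (q + q * s)     ≡⟨ cong (t +_) (sym (*-suc q s)) ⟩
    t + q * suc s       ≤⟨ +-monoʳ-≤ t (*-monoʳ-≤ q (≰⇒> t≰s)) ⟩
    suc q * t           ≤⟨ bound ⟩
    k + q * s           ∎

sunflower-core-meets : ∀ {n k t} (S : Fin (suc (suc (k ∸ t))) → Subset n) {C G : Subset n} →
  t ≤ k → ∣ G ∣ ≤ k → IsSunflower S C → (∀ i → t ≤ ∣ S i ∩ G ∣) → t ≤ ∣ C ∩ G ∣
sunflower-core-meets {n} {k} {t} S {C} {G} t≤k ∣G∣≤k sf t≤∣S∩G∣ =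
  petal-count-bound t≤k (begin
    suc (suc (k ∸ t)) * t                      ≤⟨ sunflower-size S∩G (sunflower-∩ G sf) t≤∣S∩G∣ ⟩
    ∣ ⋃⁺ S∩G ∣ + suc (k ∸ t) * ∣ C ∩ G ∣        ≤⟨ +-monoˡ-≤ _ ∣⋃S∩G∣≤k ⟩
    k + suc (k ∸ t) * ∣ C ∩ G ∣                ∎)
  where
  open ≤-Reasoning
  S∩G : Fin (suc (suc (k ∸ t))) → Subset n
  S∩G i = S i ∩ G
  ∣⋃S∩G∣≤k : ∣ ⋃⁺ S∩G ∣ ≤ k
  ∣⋃S∩G∣≤k = ≤-trans (p⊆q⇒∣p∣≤∣q∣ (⋃⁺-least S∩G (λ i → p∩q⊆q (S i) G))) ∣G∣≤k

core∉T-of-minimal-petals : ∀ {n p k t} {𝓗 : Family n} {S : Fin p → Subset n} {C : Subset n} →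
  IsSunflower S C → ∀ i j → i ≢ j → S i ≢ S j →
  MinimalInT k t 𝓗 (S i) → MinimalInT k t 𝓗 (S j) → ¬ InT k t 𝓗 C
core∉T-of-minimal-petals sf i j i≢j Sᵢ≢Sⱼ (_ , minᵢ) (_ , minⱼ) C∈T =
  minⱼ _ (core⊆petal sf j i (i≢j ∘ sym))
    (λ C≡Sⱼ → minᵢ _ (core⊆petal sf i j i≢j) (λ C≡Sᵢ → Sᵢ≢Sⱼ (trans (sym C≡Sᵢ) C≡Sⱼ)) C∈T)
    C∈T

no-sunflower-of-minimal : ∀ {n k t} (𝓗 : Family n) → t ≤ k → IsKUniform k 𝓗 →
  (C : Subset n) → ∣ C ∣ ≡ t → ¬ SunflowerIn (MinimalInT k t 𝓗) (suc (suc (k ∸ t))) C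
no-sunflower-of-minimal {k = k} {t} 𝓗 t≤k uniform C ∣C∣≡t (S , distinct , sf , minimal) =
  core∉T-of-minimal-petals sf zero (suc zero) (λ ()) (distinct zero (suc zero) (λ ()))
    (minimal zero) (minimal (suc zero)) C∈T
  where
  C∈T : InT k t 𝓗 C
  C∈T = ≤-reflexive (sym ∣C∣≡t) , subst (_≤ k) (sym ∣C∣≡t) t≤k ,
        λ H∈𝓗 → sunflower-core-meets S t≤k (≤-reflexive (uniform H∈𝓗)) sf
                  (λ i → proj₂ (proj₂ (proj₁ (minimal i))) H∈𝓗)

lemma5p1 : (n k t : ℕ) → 0 < t → t < k → k < n →
    (𝓕 𝓖 : Family n) →
    IsKUniform k 𝓕 → IsKUniform k 𝓖 →
    CrossInt t 𝓕 𝓖 → NonTrivial t 𝓕 → NonTrivial t 𝓖 →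
    Saturated k t 𝓕 𝓖 →
    (∀ (C : Subset n) → ∣ C ∣ ≡ t → ¬ SunflowerIn (InB k t 𝓕 𝓖) ((k ∸ t) + 2) C)
    × (∀ (C : Subset n) → ∣ C ∣ ≡ t → ¬ SunflowerIn (InB k t 𝓖 𝓕) ((k ∸ t) + 2) C)
lemma5p1 n k t _ t<k _ 𝓕 𝓖 uniform𝓕 uniform𝓖 _ _ _ _ =
  no-sunflower 𝓖 uniform𝓖 , no-sunflower 𝓕 uniform𝓕
  where
  no-sunflower : (𝓗 : Family n) → IsKUniform k 𝓗 →
    ∀ C → ∣ C ∣ ≡ t → ¬ SunflowerIn (MinimalInT k t 𝓗) ((k ∸ t) + 2) C
  no-sunflower 𝓗 uniform C ∣C∣≡t =
    subst (λ p → ¬ SunflowerIn (MinimalInT k t 𝓗) p C) (+-comm 2 (k ∸ t))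
      (no-sunflower-of-minimal 𝓗 (<⇒≤ t<k) uniform C ∣C∣≡t)
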